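{- Let $\mathbb{F}_q$ be a finite field of order $q$. Then: (i) If $q=2$, then $\mathrm{sdim}(\mathrm{Cl}(\mathbb{F}_q))=1$. (ii) If $q\ge 3$, then $\mathrm{sdim}(\mathrm{Cl}(\mathbb{F}_q))=2q-4$.
   Context: For a commutative ring $R$ with unity, $U(R)$ is the set of units and $\mathrm{Id}(R)$ the set of idempotents. The clean graph $\mathrm{Cl}(R)$ has vertex set $\{(e,u): e\in\mathrm{Id}(R), u\in U(R)\}$, two distinct vertices $(e,u),(f,v)$ being adjacent iff $ef=0$ or $uv=1$. In a graph, a vertex $w$ strongly resolves vertices $x,y$ if some shortest $x$–$w$ path contains $y$ or some shortest $y$–$w$ path contains $x$; a strong resolving set is a set $S$ of vertices such that every two distinct vertices are strongly resolved by some vertex of $S$; $\mathrm{sdim}$ is the smallest cardinality of a strong resolving set. -}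

module Defs where

open import Level using (Level; _⊔_)
open import Data.Nat using (ℕ; zero; suc; _≤_)
open import Data.Fin using (Fin)
open import Data.Product using (Σ; ∃; _×_; _,_; proj₁; proj₂)
open import Data.Sum using (_⊎_)
open import Data.List using (List; []; _∷_; length)
open import Data.List.Relation.Unary.Any using (Any)
open import Relation.Nullary using (¬_)
open import Relation.Binary.PropositionalEquality using (_≡_)
open import Relation.Binary.Bundles using (Setoid)
open import Algebra.Bundles using (CommutativeRing)
import Data.List.Membership.Setoid as SetoidMembership
import Data.List.Relation.Unary.Unique.Setoid as SetoidUnique

record FiniteField (c ℓ : Level) (q : ℕ) : Set (Level.suc (c ⊔ ℓ)) where
  field
    commRing : CommutativeRing c ℓ
  open CommutativeRing commRing public hiding (ring)
  field
    0≉1       : ¬ (0# ≈ 1#)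
    inverse   : ∀ x → ¬ (x ≈ 0#) → ∃ λ y → x * y ≈ 1#
    enum      : Fin q → Carrier
    enum-inj  : ∀ i j → enum i ≈ enum j → i ≡ j
    enum-surj : ∀ x → ∃ λ i → enum i ≈ x

record Graph (v ℓv ℓa : Level) : Set (Level.suc (v ⊔ ℓv ⊔ ℓa)) where
  field
    Vertex : Setoid v ℓv
  open Setoid Vertex public renaming (Carrier to V)
  field
    Adj : V → V → Set ℓa

module GraphTheory {v ℓv ℓa : Level} (G : Graph v ℓv ℓa) where
  open Graph G
  open SetoidMembership Vertex using (_∈_)
  open SetoidUnique Vertex using (Unique)

  data Walk : V → V → ℕ → Set (v ⊔ ℓa) where
    []  : ∀ {x} → Walk x x 0
    _∷_ : ∀ {x y z n} → Adj x y → Walk y z n → Walk x z (suc n)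

  vertices : ∀ {x z n} → Walk x z n → List V
  vertices {x} []      = x ∷ []
  vertices {x} (_ ∷ w) = x ∷ vertices w

  IsShortest : ∀ {x z n} → Walk x z n → Set (v ⊔ ℓa)
  IsShortest {x} {z} {n} _ = ∀ m → Walk x z m → n ≤ m

  ShortestVia : V → V → V → Set (v ⊔ ℓv ⊔ ℓa)
  ShortestVia x w y = Σ ℕ λ n → Σ (Walk x w n) λ p → IsShortest p × (y ∈ vertices p)

  StronglyResolves : V → V → V → Set (v ⊔ ℓv ⊔ ℓa)
  StronglyResolves w x y = ShortestVia x w y ⊎ ShortestVia y w x

  IsStrongResolvingSet : List V → Set (v ⊔ ℓv ⊔ ℓa)
  IsStrongResolvingSet S =
    ∀ x y → ¬ (x ≈ y) → Any (λ w → StronglyResolves w x y) S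

  SdimIs : ℕ → Set (v ⊔ ℓv ⊔ ℓa)
  SdimIs k =
    (Σ (List V) λ S → Unique S × length S ≡ k × IsStrongResolvingSet S)
    × (∀ S → Unique S → IsStrongResolvingSet S → k ≤ length S)

module _ {c ℓ : Level} (R : CommutativeRing c ℓ) where
  open CommutativeRing R

  IsIdempotent : Carrier → Set ℓ
  IsIdempotent e = e * e ≈ e

  IsUnit : Carrier → Set (c ⊔ ℓ)
  IsUnit u = ∃ λ v → u * v ≈ 1#

  CleanVertex : Set (c ⊔ ℓ)
  CleanVertex = Σ (Carrier × Carrier) λ p → IsIdempotent (proj₁ p) × IsUnit (proj₂ p)

  _≈ᵛ_ : CleanVertex → CleanVertex → Set ℓ
  ((e , u) , _) ≈ᵛ ((f , w) , _) = (e ≈ f) × (u ≈ w)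

  CleanVertexSetoid : Setoid (c ⊔ ℓ) ℓ
  CleanVertexSetoid = record
    { Carrier = CleanVertex
    ; _≈_ = _≈ᵛ_
    ; isEquivalence = record
      { refl = refl , refl
      ; sym = λ { (p , q) → sym p , sym q }
      ; trans = λ { (p , q) (p' , q') → trans p p' , trans q q' }
      }
    }

  CleanAdj : CleanVertex → CleanVertex → Set ℓ
  CleanAdj x@((e , u) , _) y@((f , w) , _) =
    ¬ (x ≈ᵛ y) × ((e * f ≈ 0#) ⊎ (u * w ≈ 1#))

  CleanGraph : Graph (c ⊔ ℓ) ℓ ℓ
  CleanGraph = record { Vertex = CleanVertexSetoid ; Adj = CleanAdj }

sdim-Cl-is : ∀ {c ℓ} → CommutativeRing c ℓ → ℕ → Set (c ⊔ ℓ)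
sdim-Cl-is R k = GraphTheory.SdimIs (CleanGraph R) k

-- The vertices of Cl(F_q) are the 2(q - 1) pairs (e, u) with e ∈ {0, 1} and u ≠ 0. A vertex
-- with e = 0 is adjacent to every other vertex, and (1, u) ~ (1, v) iff uv = 1; in particular
-- all distances are at most 2. Two distinct vertices x, y with the same idempotent are strongly
-- resolved only by themselves: either the closed neighbourhood of one contains that of the other
-- (e = 0, or e = 1 with inverse units), or they are non-adjacent, so at distance 2, and then
-- neither lies strictly inside a shortest path starting at the other. Hence a strong resolving
-- set misses at most one vertex of each idempotent, and has at least 2(q - 2) elements. For
-- q ≥ 3 the vertices other than A = (0, 1) and B = (1, 1) form a strong resolving set, since A
-- lies on the shortest path from B to any (1, u) with u ≠ 1. For q = 2 the graph is the single
-- edge A B.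
module Submission where

open import Defs
open import Level using (Level; _⊔_)
open import Data.Nat using (ℕ; _*_; _∸_; _≤_; zero; suc; _+_; _<_; z≤n; s≤s; z<s)
open import Data.Nat.Properties
  using (*-distribˡ-∸; +-identityʳ; <⇒≱; m<n+m; m≤n+m; n<1+n; <-trans; ≤-trans; ≤-refl)
open import Data.Bool using (Bool; false; true)
open import Data.Fin using (Fin; zero; suc; punchIn; punchOut; splitAt; join)
import Data.Fin.Properties as Fin
open import Data.Product using (_×_; ∃; ∃₂; _,_; proj₁; proj₂)
open import Data.Sum using (_⊎_; inj₁; inj₂; [_,_]′)
import Data.Sum as Sum
open import Data.Empty using (⊥-elim)
open import Data.List using (List; []; _∷_; length; tabulate)
open import Data.List.Properties using (length-tabulate)
open import Data.List.Relation.Unary.Any using (Any; here; there; any?)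
import Data.List.Relation.Unary.Any as Any
open import Data.List.Relation.Unary.Any.Properties using (Any-⊎⁻)
import Data.List.Relation.Unary.Any.Properties as AnyP
import Data.List.Relation.Unary.All as All
import Data.List.Relation.Unary.AllPairs as AllPairs
open import Data.List.Relation.Unary.Unique.Setoid using (Unique)
import Data.List.Relation.Unary.Unique.Setoid.Properties as UniqueP
import Data.List.Membership.Setoid as SetoidMembership
import Data.List.Membership.Setoid.Properties as Membership
open import Function using (_∘_)
open import Relation.Nullary using (¬_; yes; no; contradiction)
import Relation.Nullary.Decidable as Dec
open import Relation.Binary.Bundles using (Setoid)
open import Relation.Binary.Definitions using (Decidable; _Respects₂_)
open import Relation.Binary.PropositionalEquality using (_≡_; _≢_)
import Relation.Binary.PropositionalEquality as ≡

splitAt-injective : ∀ m {n} {i j : Fin (m + n)} → splitAt m i ≡ splitAt m j → i ≡ j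
splitAt-injective m {n} {i} {j} eq =
  ≡.trans (≡.sym (Fin.join-splitAt m n i)) (≡.trans (≡.cong (join m n) eq) (Fin.join-splitAt m n j))

module FamilyMembership {a ℓ} (A : Setoid a ℓ) where
  open Setoid A
  open SetoidMembership A using (_∈_)

  injective-family-⊆⇒≤-length : ∀ {n xs} (f : Fin n → Carrier) →
    (∀ {i j} → f i ≈ f j → i ≡ j) → (∀ i → f i ∈ xs) → n ≤ length xs
  injective-family-⊆⇒≤-length f f-inj f⊆xs =
    Fin.injective⇒≤ (λ eq → f-inj (Membership.index-injective A (f⊆xs _) (f⊆xs _) eq))

  all-but-one-∈ : Decidable _≈_ → ∀ {n xs} (f : Fin (suc n) → Carrier) →
    (∀ {i j} → i ≢ j → f i ∈ xs ⊎ f j ∈ xs) → ∃ λ m → ∀ k → f (punchIn m k) ∈ xs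
  all-but-one-∈ _≟_ {n} {xs} f pairs with Fin.all? (λ j → any? (f j ≟_) xs)
  ... | yes all∈ = zero , λ k → all∈ _
  ... | no ¬all∈ with Fin.¬∀⟶∃¬ (suc n) (λ j → f j ∈ xs) (λ j → any? (f j ≟_) xs) ¬all∈
  ...   | m , fm∉xs =
    m , λ k → Sum.fromInj₁ (λ fm∈xs → contradiction fm∈xs fm∉xs) (pairs (Fin.punchInᵢ≢i m k))

module ShortestWalks {v ℓv ℓa} (G : Graph v ℓv ℓa) (Adj-resp : Graph.Adj G Respects₂ Graph._≈_ G) where
  open Graph G
  open GraphTheory G
  open SetoidMembership Vertex using (_∈_)

  data Through (x y w : V) (n : ℕ) : Set (v ⊔ ℓv ⊔ ℓa) where
    through : ∀ {y' k m} → y ≈ y' → Walk x y' k → Walk y' w m → k + m ≡ n → Through x y w n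

  through-∈ : ∀ {x y w n} (p : Walk x w n) → y ∈ vertices p → Through x y w n
  through-∈ []      (here y≈x) = through y≈x [] [] ≡.refl
  through-∈ (a ∷ p) (here y≈x) = through y≈x [] (a ∷ p) ≡.refl
  through-∈ (a ∷ p) (there y∈p) with through-∈ p y∈p
  ... | through y≈y' q r ≡.refl = through y≈y' (a ∷ q) r ≡.refl

  end-∈ : ∀ {x w n} (p : Walk x w n) → w ∈ vertices p
  end-∈ []      = here refl
  end-∈ (_ ∷ p) = there (end-∈ p)

  shorter⇒¬IsShortest : ∀ {x w n m} (p : Walk x w n) → Walk x w m → m < n → ¬ IsShortest p
  shorter⇒¬IsShortest _ q m<n p-shortest = <⇒≱ m<n (p-shortest _ q)

  edge-isShortest : ∀ {x z} → ¬ x ≈ z → (a : Adj x z) → IsShortest (a ∷ [])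
  edge-isShortest x≉z a zero    []      = contradiction refl x≉z
  edge-isShortest x≉z a (suc m) _       = s≤s z≤n

  path₂ : ∀ {x z} y → Adj x y → Adj y z → Walk x z 2
  path₂ y a b = _∷_ {y = y} a (b ∷ [])

  path₂-isShortest : ∀ {x z} → ¬ x ≈ z → ¬ Adj x z →
    ∀ y (a : Adj x y) (b : Adj y z) → IsShortest (path₂ y a b)
  path₂-isShortest x≉z _   _ _ _ zero          []       = contradiction refl x≉z
  path₂-isShortest x≉z x≁z _ _ _ (suc zero)    (c ∷ []) = contradiction c x≁z
  path₂-isShortest x≉z x≁z _ _ _ (suc (suc m)) _        = s≤s (s≤s z≤n)

  private
    Adj-respˡ : ∀ {x x' z} → x ≈ x' → Adj x z → Adj x' z
    Adj-respˡ = proj₂ Adj-resp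
    Adj-respʳ : ∀ {x z z'} → z ≈ z' → Adj x z → Adj x z'
    Adj-respʳ = proj₁ Adj-resp

  ¬ShortestVia-dominated : ∀ {x y w} → ¬ y ≈ x → ¬ y ≈ w → ¬ x ≈ w →
    (∀ z → Adj y z → z ≈ x ⊎ Adj x z) → ¬ ShortestVia x w y
  ¬ShortestVia-dominated y≉x y≉w x≉w dom (_ , p , p-shortest , y∈p) with through-∈ p y∈p
  ... | through y≈y' [] _ _ = y≉x y≈y'
  ... | through y≈y' (_ ∷ _) [] _ = y≉w y≈y'
  ... | through {m = suc m} y≈y' (_ ∷ _) (a ∷ q) ≡.refl with dom _ (Adj-respˡ (sym y≈y') a)
  ...   | inj₂ x~z = shorter⇒¬IsShortest p (x~z ∷ q) (m<n+m (suc m) z<s) p-shortest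
  ...   | inj₁ z≈x with q
  ...     | []    = x≉w (sym z≈x)
  ...     | b ∷ r = shorter⇒¬IsShortest p (Adj-respˡ z≈x b ∷ r) (<-trans (n<1+n m) (m<n+m (suc m) z<s)) p-shortest

  ¬ShortestVia-nonadjacent : ∀ {x y w j} → ¬ y ≈ x → ¬ y ≈ w → ¬ Adj x y →
    Walk x w j → j ≤ 2 → ¬ ShortestVia x w y
  ¬ShortestVia-nonadjacent y≉x y≉w x≁y r j≤2 (_ , p , p-shortest , y∈p) with through-∈ p y∈p
  ... | through y≈y' [] _ _ = y≉x y≈y'
  ... | through y≈y' (a ∷ []) _ _ = x≁y (Adj-respʳ (sym y≈y') a)
  ... | through y≈y' (_ ∷ _ ∷ _) [] _ = y≉w y≈y'
  ... | through {k = suc (suc k)} {m = suc m} _ (_ ∷ _ ∷ _) (_ ∷ _) ≡.refl =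
    <⇒≱ 2<n (≤-trans (p-shortest _ r) j≤2)
    where
      2<n : 2 < suc (suc k) + suc m
      2<n = s≤s (s≤s (≤-trans (s≤s z≤n) (m≤n+m (suc m) k)))

  ShortestVia-middle : ∀ {x z} → ¬ x ≈ z → ¬ Adj x z → ∀ y → Adj x y → Adj y z → ShortestVia x z y
  ShortestVia-middle x≉z x≁z y a b = 2 , path₂ y a b , path₂-isShortest x≉z x≁z y a b , there (here refl)

  StronglyResolves-sym : ∀ {w x y} → StronglyResolves w x y → StronglyResolves w y x
  StronglyResolves-sym = Sum.swap

  resolving-∈ : ∀ {S x y} → IsStrongResolvingSet S → ¬ x ≈ y →
    (∀ w → StronglyResolves w x y → x ≈ w ⊎ y ≈ w) → x ∈ S ⊎ y ∈ S
  resolving-∈ {x = x} {y} S-resolving x≉y only = Any-⊎⁻ (Any.map (only _) (S-resolving x y x≉y))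

  module _ (shortest : ∀ x z → ¬ x ≈ z → ∃₂ λ n (p : Walk x z n) → IsShortest p) where

    resolves-itself : ∀ {w x y} → ¬ x ≈ y → x ≈ w → StronglyResolves w x y
    resolves-itself {w} {x} {y} x≉y x≈w with shortest y w (λ y≈w → x≉y (trans x≈w (sym y≈w)))
    ... | n , p , p-shortest = inj₂ (n , p , p-shortest , Membership.∈-resp-≈ Vertex (sym x≈w) (end-∈ p))

    isStrongResolvingSet-covering : ∀ {a b S} → (∀ x → x ≈ a ⊎ x ≈ b ⊎ x ∈ S) →
      (∀ {x y} → x ≈ a → y ≈ b → Any (λ w → StronglyResolves w x y) S) → IsStrongResolvingSet S
    isStrongResolvingSet-covering cover ab-resolved x y x≉y with cover x | cover y
    ... | inj₂ (inj₂ x∈S) | _ = Any.map (resolves-itself x≉y) x∈S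
    ... | _ | inj₂ (inj₂ y∈S) = Any.map (StronglyResolves-sym ∘ resolves-itself (x≉y ∘ sym)) y∈S
    ... | inj₁ x≈a        | inj₁ y≈a        = contradiction (trans x≈a (sym y≈a)) x≉y
    ... | inj₂ (inj₁ x≈b) | inj₂ (inj₁ y≈b) = contradiction (trans x≈b (sym y≈b)) x≉y
    ... | inj₁ x≈a        | inj₂ (inj₁ y≈b) = ab-resolved x≈a y≈b
    ... | inj₂ (inj₁ x≈b) | inj₁ y≈a        = Any.map StronglyResolves-sym (ab-resolved y≈a x≈b)

module CleanGraphOfField {c ℓ q} (F : FiniteField c ℓ q) where
  open FiniteField F renaming (_*_ to _·_)
  open import Relation.Binary.Reasoning.Setoid setoid

  infix 4 _≟_
  _≟_ : Decidable _≈_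
  x ≟ y with enum-surj x | enum-surj y
  ... | i , i↦x | j , j↦y =
    Dec.map′ (λ { ≡.refl → trans (sym i↦x) j↦y })
             (λ x≈y → enum-inj i j (trans i↦x (trans x≈y (sym j↦y))))
             (i Fin.≟ j)

  idempotent⇒0∨1 : ∀ {e} → e · e ≈ e → e ≈ 0# ⊎ e ≈ 1#
  idempotent⇒0∨1 {e} e²≈e with e ≟ 0#
  ... | yes e≈0 = inj₁ e≈0
  ... | no  e≉0 with inverse e e≉0
  ...   | e⁻¹ , ee⁻¹≈1 = inj₂ (begin
    e             ≈⟨ sym (*-identityʳ e) ⟩
    e · 1#        ≈⟨ *-congˡ (sym ee⁻¹≈1) ⟩
    e · (e · e⁻¹) ≈⟨ sym (*-assoc e e e⁻¹) ⟩
    e · e · e⁻¹   ≈⟨ *-congʳ e²≈e ⟩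
    e · e⁻¹       ≈⟨ ee⁻¹≈1 ⟩
    1#            ∎)

  inverse-unique : ∀ {u v w} → u · v ≈ 1# → u · w ≈ 1# → v ≈ w
  inverse-unique {u} {v} {w} uv≈1 uw≈1 = begin
    v             ≈⟨ sym (*-identityʳ v) ⟩
    v · 1#        ≈⟨ *-congˡ (sym uw≈1) ⟩
    v · (u · w)   ≈⟨ sym (*-assoc v u w) ⟩
    v · u · w     ≈⟨ *-congʳ (trans (*-comm v u) uv≈1) ⟩
    1# · w        ≈⟨ *-identityˡ w ⟩
    w             ∎

  1≉0 : ¬ 1# ≈ 0#
  1≉0 = 0≉1 ∘ sym

  unit⇒≉0 : ∀ {u} → IsUnit commRing u → ¬ u ≈ 0#
  unit⇒≉0 (v , uv≈1) u≈0 = 0≉1 (trans (sym (zeroˡ v)) (trans (*-congʳ (sym u≈0)) uv≈1))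

  open Graph (CleanGraph commRing) public using (V; Adj)
    renaming (_≈_ to _≃_; sym to ≃-sym; trans to ≃-trans)
  open GraphTheory (CleanGraph commRing) public
  open SetoidMembership (CleanVertexSetoid commRing) public using (_∈_)

  idemOf unitOf : V → Carrier
  idemOf x = proj₁ (proj₁ x)
  unitOf x = proj₂ (proj₁ x)

  idemOf-0∨1 : ∀ x → idemOf x ≈ 0# ⊎ idemOf x ≈ 1#
  idemOf-0∨1 (_ , e²≈e , _) = idempotent⇒0∨1 e²≈e

  infix 4 _≟ᵛ_
  _≟ᵛ_ : Decidable _≃_
  x ≟ᵛ y = (idemOf x ≟ idemOf y) Dec.×-dec (unitOf x ≟ unitOf y)

  Adj-sym : ∀ x y → Adj x y → Adj y x
  Adj-sym x y (x≉y , inj₁ ef≈0) = x≉y ∘ ≃-sym {y} {x} , inj₁ (trans (*-comm _ _) ef≈0)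
  Adj-sym x y (x≉y , inj₂ uv≈1) = x≉y ∘ ≃-sym {y} {x} , inj₂ (trans (*-comm _ _) uv≈1)

  Adj-respˡ : ∀ {x x' z} → x ≃ x' → Adj x z → Adj x' z
  Adj-respˡ {x} {x'} {z} x≃x' (x≉z , inj₁ ef≈0) =
    x≉z ∘ ≃-trans {x} {x'} {z} x≃x' , inj₁ (trans (*-congʳ (sym (proj₁ x≃x'))) ef≈0)
  Adj-respˡ {x} {x'} {z} x≃x' (x≉z , inj₂ uv≈1) =
    x≉z ∘ ≃-trans {x} {x'} {z} x≃x' , inj₂ (trans (*-congʳ (sym (proj₂ x≃x'))) uv≈1)

  Adj-respʳ : ∀ {x z z'} → z ≃ z' → Adj x z → Adj x z'
  Adj-respʳ {x} {z} {z'} z≃z' = Adj-sym z' x ∘ Adj-respˡ {z} {z'} {x} z≃z' ∘ Adj-sym x z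

  Adj-resp : Adj Respects₂ _≃_
  Adj-resp = (λ {x} {z} {z'} → Adj-respʳ {x} {z} {z'}) , λ {z} {x} {x'} → Adj-respˡ {x} {x'} {z}

  open ShortestWalks (CleanGraph commRing) Adj-resp public

  universal : ∀ x y → idemOf x ≈ 0# → ¬ x ≃ y → Adj x y
  universal x y x0 x≉y = x≉y , inj₁ (trans (*-congʳ x0) (zeroˡ _))

  idem-0≉1 : ∀ x y → idemOf x ≈ 0# → idemOf y ≈ 1# → ¬ x ≃ y
  idem-0≉1 x y x0 y1 (x≈y , _) = 0≉1 (trans (sym x0) (trans x≈y y1))

  idem-1·1≉0 : ∀ x y → idemOf x ≈ 1# → idemOf y ≈ 1# → ¬ idemOf x · idemOf y ≈ 0#
  idem-1·1≉0 x y x1 y1 ef≈0 = 1≉0 (trans (sym (trans (*-cong x1 y1) (*-identityˡ 1#))) ef≈0)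

  ¬Adj-idem1 : ∀ x y → idemOf x ≈ 1# → idemOf y ≈ 1# → ¬ unitOf x · unitOf y ≈ 1# → ¬ Adj x y
  ¬Adj-idem1 x y x1 y1 _    (_ , inj₁ ef≈0) = idem-1·1≉0 x y x1 y1 ef≈0
  ¬Adj-idem1 x y _  _  uv≉1 (_ , inj₂ uv≈1) = uv≉1 uv≈1

  hub : V
  hub = (0# , 1#) , zeroˡ 0# , 1# , *-identityˡ 1#

  shortest-walk : ∀ x z → ¬ x ≃ z → ∃₂ λ n (p : Walk x z n) → n ≤ 2 × IsShortest p
  shortest-walk x z x≉z with (idemOf x · idemOf z ≟ 0#) Dec.⊎-dec (unitOf x · unitOf z ≟ 1#)
  ... | yes x~z = 1 , (x≉z , x~z) ∷ [] , s≤s z≤n , edge-isShortest x≉z (x≉z , x~z)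
  ... | no  x≁z = 2 , path₂ hub x~hub hub~z , ≤-refl , path₂-isShortest x≉z (x≁z ∘ proj₂) hub x~hub hub~z
    where
      x~hub : Adj x hub
      x~hub = Adj-sym hub x (universal hub x refl λ hub≃x →
        x≁z (proj₂ (universal x z (sym (proj₁ hub≃x)) x≉z)))
      hub~z : Adj hub z
      hub~z = universal hub z refl λ hub≃z →
        x≁z (proj₂ (Adj-sym z x (universal z x (sym (proj₁ hub≃z)) (x≉z ∘ ≃-sym {z} {x}))))

  shortest : ∀ x z → ¬ x ≃ z → ∃₂ λ n (p : Walk x z n) → IsShortest p
  shortest x z x≉z with shortest-walk x z x≉z
  ... | n , p , _ , p-shortest = n , p , p-shortest

  universal-dominates : ∀ x → idemOf x ≈ 0# → ∀ z → z ≃ x ⊎ Adj x z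
  universal-dominates x x0 z with z ≟ᵛ x
  ... | yes z≃x = inj₁ z≃x
  ... | no  z≉x = inj₂ (universal x z x0 (z≉x ∘ ≃-sym {x} {z}))

  inverse-units-dominated : ∀ x y → idemOf x ≈ 1# → idemOf y ≈ 1# → unitOf x · unitOf y ≈ 1# →
    ∀ z → Adj y z → z ≃ x ⊎ Adj x z
  inverse-units-dominated x y x1 y1 xy≈1 z y~z with idemOf-0∨1 z | y~z
  ... | inj₁ z0 | _                 = inj₂ (Adj-sym z x (universal z x z0 (idem-0≉1 z x z0 x1)))
  ... | inj₂ z1 | (_ , inj₁ yz≈0) = contradiction yz≈0 (idem-1·1≉0 y z y1 z1)
  ... | inj₂ z1 | (_ , inj₂ yz≈1) =
    inj₁ (trans z1 (sym x1) , inverse-unique yz≈1 (trans (*-comm (unitOf y) (unitOf x)) xy≈1))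

  ¬ShortestVia-idem0 : ∀ x y w → idemOf x ≈ 0# → ¬ y ≃ x → ¬ y ≃ w → ¬ x ≃ w → ¬ ShortestVia x w y
  ¬ShortestVia-idem0 x y w x0 y≉x y≉w x≉w =
    ¬ShortestVia-dominated {x} {y} {w} y≉x y≉w x≉w (λ z _ → universal-dominates x x0 z)

  ¬ShortestVia-idem1 : ∀ x y w → idemOf x ≈ 1# → idemOf y ≈ 1# →
    ¬ y ≃ x → ¬ y ≃ w → ¬ x ≃ w → ¬ ShortestVia x w y
  ¬ShortestVia-idem1 x y w x1 y1 y≉x y≉w x≉w with unitOf x · unitOf y ≟ 1#
  ... | yes xy≈1 = ¬ShortestVia-dominated {x} {y} {w} y≉x y≉w x≉w (inverse-units-dominated x y x1 y1 xy≈1)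
  ... | no  xy≉1 with shortest-walk x w x≉w
  ...   | _ , p , n≤2 , _ = ¬ShortestVia-nonadjacent {x} {y} {w} y≉x y≉w (¬Adj-idem1 x y x1 y1 xy≉1) p n≤2

  ¬ShortestVia-sameIdem : ∀ x y w → idemOf x ≈ idemOf y →
    ¬ y ≃ x → ¬ y ≃ w → ¬ x ≃ w → ¬ ShortestVia x w y
  ¬ShortestVia-sameIdem x y w x≈y with idemOf-0∨1 x
  ... | inj₁ x0 = ¬ShortestVia-idem0 x y w x0
  ... | inj₂ x1 = ¬ShortestVia-idem1 x y w x1 (trans (sym x≈y) x1)

  sameIdem-resolvers : ∀ x y → idemOf x ≈ idemOf y → ¬ x ≃ y →
    ∀ w → StronglyResolves w x y → x ≃ w ⊎ y ≃ w
  sameIdem-resolvers x y x≈y x≉y w w-resolves with x ≟ᵛ w | y ≟ᵛ w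
  ... | yes x≃w | _       = inj₁ x≃w
  ... | no  _   | yes y≃w = inj₂ y≃w
  ... | no  x≉w | no  y≉w = ⊥-elim ([ ¬ShortestVia-sameIdem x y w x≈y (x≉y ∘ ≃-sym {y} {x}) y≉w x≉w
                                     , ¬ShortestVia-sameIdem y x w (sym x≈y) x≉y x≉w y≉w ]′ w-resolves)

  sameIdem-∈ : ∀ {S} → IsStrongResolvingSet S → ∀ x y → idemOf x ≈ idemOf y → ¬ x ≃ y → x ∈ S ⊎ y ∈ S
  sameIdem-∈ S-resolving x y x≈y x≉y =
    resolving-∈ {x = x} {y} S-resolving x≉y (sameIdem-resolvers x y x≈y x≉y)

module CleanGraphOfFiniteField {c ℓ N} (F : FiniteField c ℓ (suc (suc N))) where
  open FiniteField F
    using (Carrier; _≈_; 0#; 1#; refl; sym; trans; reflexive; zeroˡ; *-identityˡ; *-congʳ;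
           0≉1; inverse; enum; enum-inj; enum-surj; commRing)
    renaming (_*_ to _·_)
  open CleanGraphOfField F
  open FamilyMembership (CleanVertexSetoid commRing)

  -- The units are the nonzero elements, enumerated by skipping the index of 0#.
  index₀ : Fin (suc (suc N))
  index₀ = proj₁ (enum-surj 0#)

  unitAt : Fin (suc N) → Carrier
  unitAt j = enum (punchIn index₀ j)

  unitAt-injective : ∀ {i j} → unitAt i ≈ unitAt j → i ≡ j
  unitAt-injective {i} {j} e = Fin.punchIn-injective index₀ i j (enum-inj _ _ e)

  unitAt-≉0 : ∀ j → ¬ unitAt j ≈ 0#
  unitAt-≉0 j e = Fin.punchInᵢ≢i index₀ j (enum-inj _ _ (trans e (sym (proj₂ (enum-surj 0#)))))

  unitAt-surjective : ∀ u → ¬ u ≈ 0# → ∃ λ j → unitAt j ≈ u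
  unitAt-surjective u u≉0 with enum-surj u
  ... | i , i↦u = punchOut index₀≢i , trans (reflexive (≡.cong enum (Fin.punchIn-punchOut index₀≢i))) i↦u
    where
      index₀≢i : index₀ ≢ i
      index₀≢i ≡.refl = u≉0 (trans (sym i↦u) (proj₂ (enum-surj 0#)))

  idemAt : Bool → Carrier
  idemAt false = 0#
  idemAt true  = 1#

  idemAt-idempotent : ∀ b → idemAt b · idemAt b ≈ idemAt b
  idemAt-idempotent false = zeroˡ 0#
  idemAt-idempotent true  = *-identityˡ 1#

  idemAt-injective : ∀ {b b'} → idemAt b ≈ idemAt b' → b ≡ b'
  idemAt-injective {false} {false} _ = ≡.refl
  idemAt-injective {true}  {true}  _ = ≡.refl
  idemAt-injective {false} {true}  e = ⊥-elim (0≉1 e)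
  idemAt-injective {true}  {false} e = ⊥-elim (1≉0 e)

  vertex : Bool → Fin (suc N) → V
  vertex b j = (idemAt b , unitAt j) , idemAt-idempotent b , inverse (unitAt j) (unitAt-≉0 j)

  vertex-injective : ∀ b b' i j → vertex b i ≃ vertex b' j → b ≡ b' × i ≡ j
  vertex-injective b b' i j (e≈e' , u≈u') = idemAt-injective e≈e' , unitAt-injective u≈u'

  vertex-surjective : ∀ x → ∃₂ λ b j → x ≃ vertex b j
  vertex-surjective x with idemOf-0∨1 x | unitAt-surjective (unitOf x) (unit⇒≉0 (proj₂ (proj₂ x)))
  ... | inj₁ x0 | j , j↦u = false , j , x0 , sym j↦u
  ... | inj₂ x1 | j , j↦u = true  , j , x1 , sym j↦u

  allBut⊎ : Fin (suc N) → Fin (suc N) → Fin N ⊎ Fin N → V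
  allBut⊎ m₀ m₁ (inj₁ k) = vertex false (punchIn m₀ k)
  allBut⊎ m₀ m₁ (inj₂ k) = vertex true  (punchIn m₁ k)

  allBut⊎-injective : ∀ m₀ m₁ s t → allBut⊎ m₀ m₁ s ≃ allBut⊎ m₀ m₁ t → s ≡ t
  allBut⊎-injective m₀ m₁ (inj₁ k) (inj₁ k') e =
    ≡.cong inj₁ (Fin.punchIn-injective m₀ k k' (proj₂ (vertex-injective false false _ _ e)))
  allBut⊎-injective m₀ m₁ (inj₂ k) (inj₂ k') e =
    ≡.cong inj₂ (Fin.punchIn-injective m₁ k k' (proj₂ (vertex-injective true true _ _ e)))
  allBut⊎-injective m₀ m₁ (inj₁ k) (inj₂ k') e with vertex-injective false true _ _ e
  ... | () , _
  allBut⊎-injective m₀ m₁ (inj₂ k) (inj₁ k') e with vertex-injective true false _ _ e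
  ... | () , _

  -- allBut m₀ m₁ enumerates the vertices other than vertex false m₀ and vertex true m₁.
  allBut : Fin (suc N) → Fin (suc N) → Fin (N + N) → V
  allBut m₀ m₁ = allBut⊎ m₀ m₁ ∘ splitAt N

  allBut-injective : ∀ m₀ m₁ {i j} → allBut m₀ m₁ i ≃ allBut m₀ m₁ j → i ≡ j
  allBut-injective m₀ m₁ {i} {j} e = splitAt-injective N (allBut⊎-injective m₀ m₁ (splitAt N i) (splitAt N j) e)

  Any-tabulate-allBut : ∀ {p} {P : V → Set p} m₀ m₁ s →
    P (allBut⊎ m₀ m₁ s) → Any P (tabulate (allBut m₀ m₁))
  Any-tabulate-allBut {P = P} m₀ m₁ s Ps =
    AnyP.tabulate⁺ (join N N s) (≡.subst (P ∘ allBut⊎ m₀ m₁) (≡.sym (Fin.splitAt-join N N s)) Ps)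

  misses-at-most-one : ∀ {S} → IsStrongResolvingSet S → ∀ b → ∃ λ m → ∀ k → vertex b (punchIn m k) ∈ S
  misses-at-most-one S-resolving b = all-but-one-∈ _≟ᵛ_ (vertex b) λ {i} {j} i≢j →
    sameIdem-∈ S-resolving (vertex b i) (vertex b j) refl (i≢j ∘ proj₂ ∘ vertex-injective b b i j)

  resolving-length : ∀ {S} → IsStrongResolvingSet S → N + N ≤ length S
  resolving-length {S} S-resolving with misses-at-most-one S-resolving false | misses-at-most-one S-resolving true
  ... | m₀ , c₀ | m₁ , c₁ =
    injective-family-⊆⇒≤-length (allBut m₀ m₁) (allBut-injective m₀ m₁) (allBut⊎-∈ ∘ splitAt N)
    where
      allBut⊎-∈ : ∀ s → allBut⊎ m₀ m₁ s ∈ S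
      allBut⊎-∈ (inj₁ k) = c₀ k
      allBut⊎-∈ (inj₂ k) = c₁ k

  index₁ : Fin (suc N)
  index₁ = proj₁ (unitAt-surjective 1# 1≉0)

  unitAt-index₁ : unitAt index₁ ≈ 1#
  unitAt-index₁ = proj₂ (unitAt-surjective 1# 1≉0)

  unitAt-≉1 : ∀ k → ¬ unitAt (punchIn index₁ k) ≈ 1#
  unitAt-≉1 k e = Fin.punchInᵢ≢i index₁ k (unitAt-injective (trans e (sym unitAt-index₁)))

  A B : V
  A = vertex false index₁
  B = vertex true index₁

  S₀ : List V
  S₀ = tabulate (allBut index₁ index₁)

  vertex-∈-S₀ : ∀ b {j} → j ≢ index₁ → vertex b j ∈ S₀
  vertex-∈-S₀ b {j} j≢index₁ =
    ≡.subst (λ j → vertex b j ∈ S₀) (Fin.punchIn-punchOut (j≢index₁ ∘ ≡.sym)) (in-S₀ b _)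
    where
      in-S₀ : ∀ b k → vertex b (punchIn index₁ k) ∈ S₀
      in-S₀ false k = Any-tabulate-allBut index₁ index₁ (inj₁ k) (refl , refl)
      in-S₀ true  k = Any-tabulate-allBut index₁ index₁ (inj₂ k) (refl , refl)

  S₀-covers : ∀ x → x ≃ A ⊎ x ≃ B ⊎ x ∈ S₀
  S₀-covers x with vertex-surjective x
  ... | b , j , x≃bj with j Fin.≟ index₁
  ...   | no  j≢index₁ = inj₂ (inj₂ (Membership.∈-resp-≈ (CleanVertexSetoid commRing) {S₀} {vertex b j} {x}
                                         (≃-sym {x} {vertex b j} x≃bj) (vertex-∈-S₀ b j≢index₁)))
  ...   | yes ≡.refl with b
  ...     | false = inj₁ x≃bj
  ...     | true  = inj₂ (inj₁ x≃bj)

  S₀-resolving : Fin N → IsStrongResolvingSet S₀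
  S₀-resolving k = isStrongResolvingSet-covering shortest {A} {B} S₀-covers AB-resolved
    where
      w = vertex true (punchIn index₁ k)
      AB-resolved : ∀ {x y} → x ≃ A → y ≃ B → Any (λ w → StronglyResolves w x y) S₀
      AB-resolved {x} {y} (x0 , _) (y1 , y↦1) = Any-tabulate-allBut index₁ index₁ (inj₂ k) (inj₂
        (ShortestVia-middle {y} {w} y≉w y≁w x (Adj-sym x y (universal x y x0 (idem-0≉1 x y x0 y1)))
                                              (universal x w x0 (idem-0≉1 x w x0 refl))))
        where
          y≉w : ¬ y ≃ w
          y≉w (_ , u≈u') = unitAt-≉1 k (trans (sym u≈u') (trans y↦1 unitAt-index₁))
          y≁w : ¬ Adj y w
          y≁w = ¬Adj-idem1 y w y1 refl λ uu'≈1 → unitAt-≉1 k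
            (trans (sym (*-identityˡ _)) (trans (*-congʳ (sym (trans y↦1 unitAt-index₁))) uu'≈1))

  sdim-Cl : Fin N → SdimIs (N + N)
  sdim-Cl k = (S₀ , S₀-unique , length-tabulate _ , S₀-resolving k) , λ _ _ → resolving-length
    where
      S₀-unique = UniqueP.tabulate⁺ (CleanVertexSetoid commRing) (allBut-injective index₁ index₁)

sdim-Cl-order2 : ∀ {c ℓ} (F : FiniteField c ℓ 2) → sdim-Cl-is (FiniteField.commRing F) 1
sdim-Cl-order2 F = (A ∷ [] , [A]-unique , ≡.refl , [A]-resolving) , λ S _ → nonempty S
  where
    open FiniteField F using (refl)
    open CleanGraphOfField F
    open CleanGraphOfFiniteField F

    [A]-unique : Unique (CleanVertexSetoid (FiniteField.commRing F)) (A ∷ [])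
    [A]-unique = All.[] AllPairs.∷ AllPairs.[]

    [A]-resolving : IsStrongResolvingSet (A ∷ [])
    [A]-resolving = isStrongResolvingSet-covering shortest {A} {B} covers
      λ {x} {y} x≃A y≃B →
        here (resolves-itself shortest {A} {x} {y} (idem-0≉1 x y (proj₁ x≃A) (proj₁ y≃B)) x≃A)
      where
        covers : ∀ x → x ≃ A ⊎ x ≃ B ⊎ x ∈ A ∷ []
        covers x with S₀-covers x
        ... | inj₁ x≃A        = inj₁ x≃A
        ... | inj₂ (inj₁ x≃B) = inj₂ (inj₁ x≃B)
        ... | inj₂ (inj₂ ())

    nonempty : ∀ S → IsStrongResolvingSet S → 1 ≤ length S
    nonempty S S-resolving with S-resolving A B (idem-0≉1 A B refl refl)
    ... | here  _ = s≤s z≤n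
    ... | there _ = s≤s z≤n

2*[2+n]∸4≡n+n : ∀ n → 2 * (2 + n) ∸ 4 ≡ n + n
2*[2+n]∸4≡n+n n = ≡.trans (≡.sym (*-distribˡ-∸ 2 (2 + n) 2)) (≡.cong (n +_) (+-identityʳ n))

sdim-Cl-order≥3 : ∀ {c ℓ n} (F : FiniteField c ℓ (3 + n)) → sdim-Cl-is (FiniteField.commRing F) (2 * (3 + n) ∸ 4)
sdim-Cl-order≥3 {n = n} F =
  ≡.subst (sdim-Cl-is (FiniteField.commRing F)) (≡.sym (2*[2+n]∸4≡n+n (suc n)))
          (CleanGraphOfFiniteField.sdim-Cl F zero)

corollary4p7 : ∀ {c ℓ : Level} (q : ℕ) (F : FiniteField c ℓ q) →
    (q ≡ 2 → sdim-Cl-is (FiniteField.commRing F) 1)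
    × (3 ≤ q → sdim-Cl-is (FiniteField.commRing F) (2 * q ∸ 4))
corollary4p7 q F = (λ { ≡.refl → sdim-Cl-order2 F }) , λ { (s≤s (s≤s (s≤s _))) → sdim-Cl-order≥3 F }
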